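{- Every nonempty well-behaved sequence set $X\subseteq B^n$ has a nonempty set of prunable channels $p(X)$.
   Context: $B=\{0,1\}$, $[n]=\{1,\dots,n\}$. The one-hot sequence $e^{(i,n)}\in B^n$ has a $1$ exactly at position $i$; $p(X)=\{i\in[n]\mid e^{(i,n)}\in X\}$ is the set of prunable channels of $X$. Threshold sets: for a permutation $y$ of $(1,\dots,n)$, $T(y)=\{([y_1\ge k],\dots,[y_n\ge k])\mid 1\le k\le n+1\}$, where $[P]=1$ if $P$ holds and $0$ otherwise. $X\subseteq B^n$ is well-behaved if it is a union of threshold sets. -}

module Defs where

open import Data.Bool using (Bool)
open import Data.Nat using (ℕ; suc; _≤_; _≤?_)
open import Data.Fin using (Fin; toℕ; _≟_)
open import Data.Fin.Permutation using (Permutation′; _⟨$⟩ʳ_)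
open import Data.Vec using (Vec; tabulate)
open import Data.Product using (Σ; _×_; ∃)
open import Relation.Nullary using (does)
open import Relation.Binary.PropositionalEquality using (_≡_)
open import Function.Bundles using (_⇔_)

Seq : ℕ → Set
Seq n = Vec Bool n

SeqSet : ℕ → Set₁
SeqSet n = Seq n → Set

-- one-hot sequence e^(i,n) (positions indexed by Fin n, i.e. 0-based)
oneHot : ∀ {n} → Fin n → Seq n
oneHot i = tabulate (λ j → does (j ≟ i))

prunable : ∀ {n} → SeqSet n → Fin n → Set
prunable X i = X (oneHot i)

-- a permutation y of (1,…,n): y_i = 1 + toℕ (π i) for a bijection π of Fin n
permVal : ∀ {n} → Permutation′ n → Fin n → ℕ
permVal π i = suc (toℕ (π ⟨$⟩ʳ i))

thresholdSeq : ∀ {n} → Permutation′ n → ℕ → Seq n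
thresholdSeq π k = tabulate (λ i → does (k ≤? permVal π i))

InThreshold : ∀ {n} → Permutation′ n → Seq n → Set
InThreshold {n} π x = ∃ λ k → (1 ≤ k) × (k ≤ suc n) × (x ≡ thresholdSeq π k)

WellBehaved : ∀ {n} → SeqSet n → Set₁
WellBehaved {n} X =
  Σ (Permutation′ n → Set) λ Y →
    ∀ x → X x ⇔ (Σ (Permutation′ n) λ π → Y π × InThreshold π x)

Nonempty : ∀ {n} → SeqSet n → Set
Nonempty {n} X = Σ (Seq n) X

{-# OPTIONS --safe #-}
module Submission where

-- A nonempty well-behaved set contains some threshold set T(y) entirely. The
-- threshold at the top level k = n singles out the unique position where y
-- takes its maximum value n, so it is the one-hot sequence at that position.

open import Defs
open import Data.Nat using (ℕ; _≤_; _≤?_; suc; s≤s; z≤n)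
open import Data.Nat.Properties using (≤-antisym; ≤-reflexive; n≤1+n)
open import Data.Fin using (Fin; toℕ; fromℕ; _≟_)
open import Data.Fin.Properties using (toℕ-injective; toℕ-fromℕ; toℕ≤pred[n])
open import Data.Fin.Permutation using (Permutation′; _⟨$⟩ʳ_; _⟨$⟩ˡ_; inverseˡ; inverseʳ)
open import Data.Vec.Properties using (tabulate-cong)
open import Data.Product using (Σ; _,_; proj₁)
open import Relation.Nullary.Decidable using (does-⇔)
open import Relation.Binary.PropositionalEquality using (_≡_; refl; sym; trans; cong; subst)
open import Function.Bundles using (_⇔_; mk⇔; Equivalence)

toℕ≥⇒≡fromℕ : ∀ {m} (i : Fin (suc m)) → m ≤ toℕ i → i ≡ fromℕ m
toℕ≥⇒≡fromℕ {m} i m≤i =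
  toℕ-injective (trans (≤-antisym (toℕ≤pred[n] i) m≤i) (sym (toℕ-fromℕ m)))

top≤permVal⇔argmax : ∀ {m} (π : Permutation′ (suc m)) (j : Fin (suc m)) →
  (suc m ≤ permVal π j) ⇔ (j ≡ π ⟨$⟩ˡ fromℕ m)
top≤permVal⇔argmax {m} π j = mk⇔ to from
  where
  to : suc m ≤ permVal π j → j ≡ π ⟨$⟩ˡ fromℕ m
  to (s≤s m≤πj) = trans (sym (inverseˡ π)) (cong (π ⟨$⟩ˡ_) (toℕ≥⇒≡fromℕ (π ⟨$⟩ʳ j) m≤πj))

  from : j ≡ π ⟨$⟩ˡ fromℕ m → suc m ≤ permVal π j
  from refl = s≤s (≤-reflexive (sym (trans (cong toℕ (inverseʳ π)) (toℕ-fromℕ m))))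

thresholdSeq-top≡oneHot : ∀ {m} (π : Permutation′ (suc m)) →
  thresholdSeq π (suc m) ≡ oneHot (π ⟨$⟩ˡ fromℕ m)
thresholdSeq-top≡oneHot {m} π =
  tabulate-cong (λ j → does-⇔ (top≤permVal⇔argmax π j) (suc m ≤? permVal π j) (j ≟ π ⟨$⟩ˡ fromℕ m))

threshold⊆wellBehaved : ∀ {n} {X : SeqSet n} (wb : WellBehaved X) {π : Permutation′ n} →
  proj₁ wb π → ∀ {k} → 1 ≤ k → k ≤ suc n → X (thresholdSeq π k)
threshold⊆wellBehaved (_ , X⇔⋃T) {π} π∈Y {k} 1≤k k≤1+n =
  Equivalence.from (X⇔⋃T (thresholdSeq π k)) (π , π∈Y , k , 1≤k , k≤1+n , refl)

nonempty-wellBehaved⇒generator : ∀ {n} {X : SeqSet n} (wb : WellBehaved X) →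
  Nonempty X → Σ (Permutation′ n) (proj₁ wb)
nonempty-wellBehaved⇒generator (_ , X⇔⋃T) (x , x∈X)
  with π , π∈Y , _ ← Equivalence.to (X⇔⋃T x) x∈X = π , π∈Y

mainTheorem15 : (n : ℕ) → 1 ≤ n → (X : SeqSet n) → WellBehaved X → Nonempty X →
    Σ (Fin n) (prunable X)
mainTheorem15 (suc m) _ X wb X≠∅
  with π , π∈Y ← nonempty-wellBehaved⇒generator wb X≠∅ =
  π ⟨$⟩ˡ fromℕ m ,
  subst X (thresholdSeq-top≡oneHot π) (threshold⊆wellBehaved wb π∈Y (s≤s z≤n) (s≤s (n≤1+n m)))
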